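{- Let $m,n\ge 1$ and $t>2$ be integers, and let $G_{m,n}$ be the $m\times n$ grid graph. Then \[\gamma_{t,2}(G_{m,n}) \le \left\lfloor \frac{(m+2(t-2))(n+2(t-2))}{2(t-1)^2}\right\rfloor .\]
   Context: The $m\times n$ grid graph $G_{m,n}$ has vertex set $\{(i,j)\in\mathbb{Z}^2: 0\le i<m,\ 0\le j<n\}$, with two vertices adjacent iff they differ by 1 in exactly one coordinate. For a graph $G=(V,E)$ and positive integers $t,r$, a tower vertex $T\in V$ supplies to a vertex $v\in V$ the signal $sig(T,v)=\max(t-dist(T,v),0)$, where $dist$ is the graph (shortest-path) distance. A $(t,r)$ broadcast on $G$ is a set $\mathbb{T}\subseteq V$ such that for every $v\in V$, $\sum_{T\in\mathbb{T}} sig(T,v)\ge r$. The $(t,r)$ broadcast domination number $\gamma_{t,r}(G)$ is the minimum cardinality of a $(t,r)$ broadcast on $G$. -}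

module Defs where

open import Data.Nat using (ℕ; zero; suc; _+_; _*_; _∸_; _^_; _≡ᵇ_; ∣_-_∣)
open import Data.Nat.DivMod using (_/_)
open import Data.Fin using (Fin; toℕ)
open import Data.Fin.Properties using (_≟_)
open import Data.Product using (_×_; _,_)
open import Data.Bool using (Bool; true; false; _∧_; _∨_)
open import Data.List using (List; []; _∷_; allFin; cartesianProduct; map; length)
open import Data.Bool.ListAction using (any)
open import Data.Nat.ListAction using (sum)
open import Relation.Nullary.Decidable using (⌊_⌋)

Vertex : ℕ → ℕ → Set
Vertex m n = Fin m × Fin n

vertices : (m n : ℕ) → List (Vertex m n)
vertices m n = cartesianProduct (allFin m) (allFin n)

adj : {m n : ℕ} → Vertex m n → Vertex m n → Bool
adj (i , j) (i' , j') =
  (⌊ i ≟ i' ⌋ ∧ (∣ toℕ j - toℕ j' ∣ ≡ᵇ 1)) ∨ (⌊ j ≟ j' ⌋ ∧ (∣ toℕ i - toℕ i' ∣ ≡ᵇ 1))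

eqV : {m n : ℕ} → Vertex m n → Vertex m n → Bool
eqV (i , j) (i' , j') = ⌊ i ≟ i' ⌋ ∧ ⌊ j ≟ j' ⌋

within : (m n : ℕ) → ℕ → Vertex m n → Vertex m n → Bool
within m n zero u v = eqV u v
within m n (suc k) u v =
  within m n k u v ∨ any (λ w → within m n k u w ∧ adj w v) (vertices m n)

search : (m n : ℕ) → Vertex m n → Vertex m n → ℕ → ℕ → ℕ
search m n u v k zero = k
search m n u v k (suc fuel) with within m n k u v
... | true  = k
... | false = search m n u v (suc k) fuel

-- graph (shortest-path) distance in G_{m,n}: the least k such that a walk of
-- length ≤ k joins u and v. (G_{m,n} is connected with m*n vertices, so the
-- distance is < m * n and the search with fuel m * n finds it.)
dist : (m n : ℕ) → Vertex m n → Vertex m n → ℕ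
dist m n u v = search m n u v 0 (m * n)

-- signal sig(T,v) = max(t - dist(T,v), 0)  (truncated subtraction on ℕ)
sig : (m n t : ℕ) → Vertex m n → Vertex m n → ℕ
sig m n t T v = t ∸ dist m n T v

totalSig : (m n t : ℕ) → List (Vertex m n) → Vertex m n → ℕ
totalSig m n t towers v = sum (map (λ T → sig m n t T v) towers)

IsBroadcast : (m n t r : ℕ) → List (Vertex m n) → Set
IsBroadcast m n t r towers = (v : Vertex m n) → r Data.Nat.≤ totalSig m n t towers v

-- the bound  ⌊ (m + 2(t-2)) (n + 2(t-2)) / (2 (t-1)^2) ⌋, for t ≥ 3
-- (for t ≤ 2 it is set to 0; the theorem only uses t > 2)
gridBound : (m n t : ℕ) → ℕ
gridBound m n (suc (suc (suc k))) =
  ((m + 2 * suc k) * (n + 2 * suc k)) / (2 * (suc (suc k)) ^ 2)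
gridBound m n _ = 0

module Submission where

-- Write s = t - 1. The graph distance of G_{m,n} is at most the Manhattan distance
-- (dist≤manhattan), so a tower at Manhattan distance d supplies signal ≥ s + 1 - d. A vertex
-- therefore receives signal ≥ 2 once it is 'Covered': some tower lies at distance < s, or two
-- distinct towers lie at total distance ≤ 2s (broadcast-of-covered). Two tower sets cover:
--   * m, n ≥ 2: the black squares (i + j odd) of the lattice s ℤ × s ℤ, clamped into the grid.
--     Every vertex lies in a lattice cell, whose two black corners are opposite corners and so
--     at total distance ≤ 2s; at most half of the lattice points are black (GridConstruction).
--   * m = 1 or n = 1: towers at s - 1, 3s - 1, 5s - 1, … along the line (LineConstruction).

open import Defs
open import Data.Nat using (ℕ; zero; suc; _+_; _*_; _∸_; _^_; _≤_; _<_; _⊓_; z≤n; s≤s; ∣_-_∣)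
open import Data.Nat.Properties
open import Data.Nat.DivMod using (m*n/n≡m; /-monoˡ-≤)
open import Data.Nat.ListAction using (sum)
open import Data.Nat.Tactic.RingSolver using (solve-∀)
open import Data.Fin using (Fin; toℕ; fromℕ<; inject₁) renaming (zero to fzero; suc to fsuc)
open import Data.Fin.Properties
  using (toℕ-injective; toℕ<n; toℕ-fromℕ<; toℕ-inject₁) renaming (_≟_ to _≟ᶠ_)
open import Data.Bool using (Bool; true; false; not; T; _∧_; if_then_else_)
open import Data.Bool.Properties using (T-∨; T-∧; ∨-zeroʳ; not-involutive)
open import Data.Product using (Σ; _×_; _,_; proj₁; proj₂)
open import Data.Sum using (inj₁; inj₂)
open import Data.Empty using (⊥-elim)
open import Data.List using (List; _∷_; map; length; filter; cartesianProduct; downFrom)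
open import Data.List.Properties using (map-∘; filter-++; length-++; length-map; length-downFrom)
open import Data.List.Membership.Propositional using (_∈_; lose)
open import Data.List.Membership.Propositional.Properties
  using (∈-cartesianProduct⁺; ∈-cartesianProduct⁻; ∈-allFin; ∈-filter⁺; ∈-filter⁻
        ; ∈-downFrom⁺; ∈-downFrom⁻)
open import Data.List.Relation.Unary.Any using (here; there)
open import Data.List.Relation.Unary.Any.Properties using (any⁺)
import Data.List.Relation.Unary.All as All
import Data.List.Relation.Unary.All.Properties as All
open import Data.List.Relation.Unary.AllPairs using ([]; _∷_)
open import Data.List.Relation.Unary.Unique.Propositional using (Unique)
open import Data.List.Relation.Unary.Unique.Propositional.Properties
  using (filter⁺; cartesianProduct⁺; downFrom⁺)
open import Relation.Nullary using (¬_; yes; no; T?)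
open import Relation.Nullary.Decidable using (⌊_⌋; dec-true; isYes≗does)
open import Relation.Unary using (Decidable)
open import Relation.Binary.Definitions using (tri<; tri≈; tri>)
open import Relation.Binary.PropositionalEquality
open import Function using (Equivalence)

open Equivalence using (from)

manhattan : {m n : ℕ} → Vertex m n → Vertex m n → ℕ
manhattan (i , j) (i' , j') = ∣ toℕ i - toℕ i' ∣ + ∣ toℕ j - toℕ j' ∣

∣n-1+n∣≡1 : ∀ n → ∣ n - suc n ∣ ≡ 1
∣n-1+n∣≡1 zero    = refl
∣n-1+n∣≡1 (suc n) = ∣n-1+n∣≡1 n

∣-∣-step-up : ∀ {a c} → c < a → suc ∣ a - suc c ∣ ≡ ∣ a - c ∣
∣-∣-step-up {suc a} {zero}  _         = cong suc (∣-∣-identityʳ a)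
∣-∣-step-up {suc a} {suc c} (s≤s c<a) = ∣-∣-step-up c<a

∣-∣-step-down : ∀ {a c} → a ≤ c → suc ∣ a - c ∣ ≡ ∣ a - suc c ∣
∣-∣-step-down z≤n       = refl
∣-∣-step-down (s≤s a≤c) = ∣-∣-step-down a≤c

stepTowards : ∀ {m} (a c : Fin m) → toℕ a ≢ toℕ c →
  Σ (Fin m) λ c' → ∣ toℕ c' - toℕ c ∣ ≡ 1 × suc ∣ toℕ a - toℕ c' ∣ ≡ ∣ toℕ a - toℕ c ∣
stepTowards {m} a c a≢c with <-cmp (toℕ c) (toℕ a)
... | tri≈ _ c≡a _ = ⊥-elim (a≢c (sym c≡a))
... | tri< c<a _ _ = fromℕ< c+1<m , unit , closer
  where
    c+1<m : suc (toℕ c) < m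
    c+1<m = ≤-<-trans c<a (toℕ<n a)
    unit : ∣ toℕ (fromℕ< c+1<m) - toℕ c ∣ ≡ 1
    unit rewrite toℕ-fromℕ< c+1<m = trans (∣-∣-comm (suc (toℕ c)) (toℕ c)) (∣n-1+n∣≡1 (toℕ c))
    closer : suc ∣ toℕ a - toℕ (fromℕ< c+1<m) ∣ ≡ ∣ toℕ a - toℕ c ∣
    closer rewrite toℕ-fromℕ< c+1<m = ∣-∣-step-up c<a
... | tri> _ _ a<c = stepDown c a<c
  where
    stepDown : ∀ {m} (c : Fin m) → toℕ a < toℕ c →
      Σ (Fin m) λ c' → ∣ toℕ c' - toℕ c ∣ ≡ 1 × suc ∣ toℕ a - toℕ c' ∣ ≡ ∣ toℕ a - toℕ c ∣
    stepDown (fsuc c₀) (s≤s a≤c₀) rewrite sym (toℕ-inject₁ c₀) =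
      inject₁ c₀ , ∣n-1+n∣≡1 (toℕ (inject₁ c₀)) , ∣-∣-step-down a≤c₀

manhattan-zero : {m n : ℕ} (u v : Vertex m n) → manhattan u v ≡ 0 → u ≡ v
manhattan-zero (i , j) (i' , j') d≡0 =
  cong₂ _,_ (toℕ-injective (∣m-n∣≡0⇒m≡n (m+n≡0⇒m≡0 _ d≡0)))
            (toℕ-injective (∣m-n∣≡0⇒m≡n (m+n≡0⇒n≡0 ∣ toℕ i - toℕ i' ∣ d≡0)))

≟ᶠ-refl : {m : ℕ} (a : Fin m) → ⌊ a ≟ᶠ a ⌋ ≡ true
≟ᶠ-refl a = trans (isYes≗does (a ≟ᶠ a)) (dec-true (a ≟ᶠ a) refl)

adj-row : {m n : ℕ} (c' c : Fin m) (e : Fin n) → ∣ toℕ c' - toℕ c ∣ ≡ 1 → T (adj (c' , e) (c , e))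
adj-row c' c e unit rewrite ≟ᶠ-refl e | unit = subst T (sym (∨-zeroʳ _)) _

adj-column : {m n : ℕ} (c : Fin m) (e' e : Fin n) → ∣ toℕ e' - toℕ e ∣ ≡ 1 → T (adj (c , e') (c , e))
adj-column c e' e unit rewrite ≟ᶠ-refl c | unit = _

neighbourTowards : {m n d : ℕ} (u v : Vertex m n) → manhattan u v ≡ suc d →
  Σ (Vertex m n) λ w → T (adj w v) × manhattan u w ≡ d
neighbourTowards (a , b) (c , e) uv with toℕ a ≟ toℕ c
... | no a≢c =
  let (c' , unit , closer) = stepTowards a c a≢c in
  (c' , e) , adj-row c' c e unit ,
  suc-injective (trans (cong (_+ ∣ toℕ b - toℕ e ∣) closer) uv)
... | yes a≡c =
  let (e' , unit , closer) = stepTowards b e b≢e in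
  (c , e') , adj-column c e' e unit ,
  suc-injective (trans (sym (+-suc ∣ toℕ a - toℕ c ∣ _))
                       (trans (cong (∣ toℕ a - toℕ c ∣ +_) closer) uv))
  where
    b≢e : toℕ b ≢ toℕ e
    b≢e b≡e = 0≢1+n (trans (sym (cong₂ _+_ (m≡n⇒∣m-n∣≡0 a≡c) (m≡n⇒∣m-n∣≡0 b≡e))) uv)

∈-vertices : {m n : ℕ} (v : Vertex m n) → v ∈ vertices m n
∈-vertices (i , j) = ∈-cartesianProduct⁺ (∈-allFin i) (∈-allFin j)

within-refl : {m n : ℕ} (u : Vertex m n) → T (within m n 0 u u)
within-refl (i , j) rewrite ≟ᶠ-refl i | ≟ᶠ-refl j = _

within-step : {m n k : ℕ} {u w v : Vertex m n} →
  T (within m n k u w) → T (adj w v) → T (within m n (suc k) u v)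
within-step {m} {n} {k} {u} {w} {v} uw wv =
  from (T-∨ {within m n k u v}) (inj₂ (any⁺ (λ x → within m n k u x ∧ adj x v)
    (lose (∈-vertices w) (from (T-∧ {within m n k u w}) (uw , wv)))))

within-manhattan : {m n : ℕ} (d : ℕ) (u v : Vertex m n) → manhattan u v ≡ d → T (within m n d u v)
within-manhattan zero u v uv = subst (λ w → T (within _ _ 0 u w)) (manhattan-zero u v uv) (within-refl u)
within-manhattan (suc d) u v uv =
  let (w , wv , uw) = neighbourTowards u v uv in within-step {k = d} {u} {w} {v} (within-manhattan d u w uw) wv

search-bound : {m n : ℕ} (u v : Vertex m n) (K k fuel : ℕ) → k ≤ K → T (within m n K u v) →
  search m n u v k fuel ≤ K
search-bound u v K k zero k≤K _ = k≤K
search-bound {m} {n} u v K k (suc fuel) k≤K reach with within m n k u v in eq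
... | true  = k≤K
... | false with m≤n⇒m<n∨m≡n k≤K
...   | inj₁ k<K  = search-bound u v K (suc k) fuel k<K reach
...   | inj₂ refl = ⊥-elim (subst T eq reach)

dist≤manhattan : {m n : ℕ} (u v : Vertex m n) → dist m n u v ≤ manhattan u v
dist≤manhattan {m} {n} u v =
  search-bound u v (manhattan u v) 0 (m * n) z≤n (within-manhattan (manhattan u v) u v refl)

+-interchange : ∀ w x y z → (w + x) + (y + z) ≡ (w + y) + (x + z)
+-interchange = solve-∀

∸-subadditive : ∀ a b d e → (a + b) ∸ (d + e) ≤ (a ∸ d) + (b ∸ e)
∸-subadditive a b d e = m≤n+o⇒m∸n≤o (a + b) (d + e) (begin
  a + b                          ≤⟨ +-mono-≤ (m≤n+m∸n a d) (m≤n+m∸n b e) ⟩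
  (d + (a ∸ d)) + (e + (b ∸ e))  ≡⟨ +-interchange d (a ∸ d) e (b ∸ e) ⟩
  (d + e) + ((a ∸ d) + (b ∸ e))  ∎)
  where open ≤-Reasoning

signal-near : ∀ {s d} → d < s → 2 ≤ suc s ∸ d
signal-near d<s = m+n≤o⇒m≤o∸n 2 (s≤s d<s)

signal-pair : ∀ {s d e} → d + e ≤ 2 * s → 2 ≤ (suc s ∸ d) + (suc s ∸ e)
signal-pair {s} {d} {e} d+e≤2s = ≤-trans
  (m+n≤o⇒m≤o∸n 2 (≤-trans (+-monoʳ-≤ 2 d+e≤2s) (≤-reflexive (two-ranges s))))
  (∸-subadditive (suc s) (suc s) d e)
  where
    two-ranges : ∀ s → 2 + 2 * s ≡ suc s + suc s
    two-ranges = solve-∀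

sum-map-∈ : {A : Set} (h : A → ℕ) {x : A} {xs : List A} → x ∈ xs → h x ≤ sum (map h xs)
sum-map-∈ h (here refl)               = m≤m+n _ _
sum-map-∈ h {xs = y ∷ _} (there x∈xs) = ≤-trans (sum-map-∈ h x∈xs) (m≤n+m _ (h y))

sum-map-pair : {A : Set} (h : A → ℕ) {x y : A} {xs : List A} → x ∈ xs → y ∈ xs → x ≢ y →
  h x + h y ≤ sum (map h xs)
sum-map-pair h (here refl) (here refl) x≢y = ⊥-elim (x≢y refl)
sum-map-pair h (here refl) (there y∈xs) _  = +-monoʳ-≤ (h _) (sum-map-∈ h y∈xs)
sum-map-pair h {x} {y} {_ ∷ zs} (there x∈xs) (here refl) _ =
  subst (_≤ h y + sum (map h zs)) (+-comm (h y) (h x)) (+-monoʳ-≤ (h y) (sum-map-∈ h x∈xs))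
sum-map-pair h {xs = z ∷ _} (there x∈xs) (there y∈xs) x≢y =
  ≤-trans (sum-map-pair h x∈xs y∈xs x≢y) (m≤n+m _ (h z))

data Covered {m n : ℕ} {I : Set} (s : ℕ) (f : I → Vertex m n) (idx : List I)
             (v : Vertex m n) : Set where
  near    : {x : I} → x ∈ idx → manhattan (f x) v < s → Covered s f idx v
  between : {x y : I} → x ∈ idx → y ∈ idx → x ≢ y →
            manhattan (f x) v + manhattan (f y) v ≤ 2 * s → Covered s f idx v

-- Covering every vertex at range s yields a (s + 1, 2) broadcast, since the signal of a
-- tower is at least s + 1 minus its Manhattan distance.
broadcast-of-covered : {m n : ℕ} {I : Set} (s : ℕ) (f : I → Vertex m n) (idx : List I) →
  ((v : Vertex m n) → Covered s f idx v) → IsBroadcast m n (suc s) 2 (map f idx)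
broadcast-of-covered {m} {n} {I} s f idx covered v =
  subst (2 ≤_) (cong sum (map-∘ idx)) (received (covered v))
  where
    signal : I → ℕ
    signal x = sig m n (suc s) (f x) v

    signal≥ : ∀ x → suc s ∸ manhattan (f x) v ≤ signal x
    signal≥ x = ∸-monoʳ-≤ (suc s) (dist≤manhattan (f x) v)

    received : Covered s f idx v → 2 ≤ sum (map signal idx)
    received (near x∈idx d<s) =
      ≤-trans (signal-near d<s) (≤-trans (signal≥ _) (sum-map-∈ signal x∈idx))
    received (between {x} {y} x∈idx y∈idx x≢y d+e≤2s) =
      ≤-trans (signal-pair {s} {manhattan (f x) v} {manhattan (f y) v} d+e≤2s)
        (≤-trans (+-mono-≤ (signal≥ x) (signal≥ y)) (sum-map-pair signal x∈idx y∈idx x≢y))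

map-injectiveOn⁺ : {A B : Set} (f : A → B) {xs : List A} → Unique xs →
  (∀ {x y} → x ∈ xs → y ∈ xs → f x ≡ f y → x ≡ y) → Unique (map f xs)
map-injectiveOn⁺ f [] _ = []
map-injectiveOn⁺ f (x∉xs ∷ unique) inj =
  All.map⁺ (All.tabulate λ y∈xs fx≡fy → All.lookup x∉xs y∈xs (inj (here refl) (there y∈xs) fx≡fy))
  ∷ map-injectiveOn⁺ f unique (λ x∈xs y∈xs → inj (there x∈xs) (there y∈xs))

-- The number of cells [k g, (k+1) g] needed to reach M: M ≤ (last + 1) g < M + g.
record Ceiling (g M : ℕ) : Set where
  field
    last    : ℕ
    reaches : M ≤ suc last * g
    tight   : suc last * g < M + g

ceiling : ∀ g M → Ceiling (suc g) (suc M)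
ceiling g zero = record
  { last = 0 ; reaches = s≤s z≤n ; tight = s≤s (≤-reflexive (+-identityʳ (suc g))) }
ceiling g (suc M) with ceiling g M
... | record { last = K ; reaches = reaches ; tight = tight } with suc (suc M) ≤? suc K * suc g
...   | yes reaches′ = record { last = K ; reaches = reaches′ ; tight = m<n⇒m<1+n tight }
...   | no  short    = record
  { last    = suc K
  ; reaches = subst (suc (suc M) ≤_) (cong (suc g +_) (sym full)) (+-monoˡ-≤ (suc M) (s≤s z≤n))
  ; tight   = subst (_< suc (suc M) + suc g) (trans (+-comm (suc M) (suc g)) (cong (suc g +_) (sym full)))
                    (n<1+n (suc M + suc g))
  }
  where
    full : suc K * suc g ≡ suc M
    full = ≤-antisym (≤-pred (≰⇒> short)) reaches

clampedAP : (a g M i : ℕ) → ℕ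
clampedAP a g M i = (a + i * g) ⊓ M

ap-succ : ∀ a g i → a + suc i * g ≡ a + i * g + g
ap-succ = solve-∀

clampedAP-step : ∀ a g M i → clampedAP a g M (suc i) ≤ clampedAP a g M i + g
clampedAP-step a g M i = begin
  (a + suc i * g) ⊓ M        ≤⟨ ⊓-mono-≤ (≤-reflexive (ap-succ a g i)) (m≤m+n M g) ⟩
  (a + i * g + g) ⊓ (M + g)  ≡⟨ +-distribʳ-⊓ g (a + i * g) M ⟨
  (a + i * g) ⊓ M + g        ∎
  where open ≤-Reasoning

clampedAP-strict : ∀ {a g M K i j} → 0 < g → a + K * g < M + g → i < j → j ≤ K →
  clampedAP a g M i < clampedAP a g M j
clampedAP-strict {a} {g} {M} {K} {i} {j} 0<g top i<j j≤K =
  subst (_< clampedAP a g M j) (sym (m≤n⇒m⊓n≡m (<⇒≤ term<M))) (⊓-pres-m< term<a+jg term<M)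
  where
    term+g≤ : a + i * g + g ≤ a + j * g
    term+g≤ = ≤-trans (≤-reflexive (sym (ap-succ a g i))) (+-monoʳ-≤ a (*-monoˡ-≤ g i<j))
    term<M : a + i * g < M
    term<M = +-cancelʳ-< g _ _ (≤-<-trans term+g≤ (≤-<-trans (+-monoʳ-≤ a (*-monoˡ-≤ g j≤K)) top))
    term<a+jg : a + i * g < a + j * g
    term<a+jg = <-≤-trans (m<m+n _ 0<g) term+g≤

clampedAP-injective : ∀ {a g M K i j} → 0 < g → a + K * g < M + g → i ≤ K → j ≤ K →
  clampedAP a g M i ≡ clampedAP a g M j → i ≡ j
clampedAP-injective {i = i} {j} 0<g top i≤K j≤K same with <-cmp i j
... | tri< i<j _ _ = ⊥-elim (<-irrefl same (clampedAP-strict 0<g top i<j j≤K))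
... | tri≈ _ i≡j _ = i≡j
... | tri> _ _ j<i = ⊥-elim (<-irrefl (sym same) (clampedAP-strict 0<g top j<i i≤K))

bracket : (P : ℕ → ℕ) (K p : ℕ) → P 0 ≤ p → p < P K →
  Σ ℕ λ i → i < K × P i ≤ p × p ≤ P (suc i)
bracket P zero    p lo hi = ⊥-elim (<⇒≱ hi lo)
bracket P (suc K) p lo hi with P K ≤? p
... | yes PK≤p = K , ≤-refl , PK≤p , <⇒≤ hi
... | no  PK≰p =
  let (i , i<K , Pi≤p , p≤Pi+1) = bracket P K p lo (≰⇒> PK≰p) in i , m<n⇒m<1+n i<K , Pi≤p , p≤Pi+1

ends-distance : ∀ {l p r g} → l ≤ p → p ≤ r → r ≤ l + g → ∣ l - p ∣ + ∣ r - p ∣ ≤ g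
ends-distance {l} {p} {r} {g} l≤p p≤r r≤l+g = begin
  ∣ l - p ∣ + ∣ r - p ∣    ≡⟨ cong₂ _+_ (m≤n⇒∣m-n∣≡n∸m l≤p) (m≤n⇒∣n-m∣≡n∸m p≤r) ⟩
  (p ∸ l) + (r ∸ p)        ≡⟨ +-comm (p ∸ l) (r ∸ p) ⟩
  (r ∸ p) + (p ∸ l)        ≡⟨ +-∸-assoc (r ∸ p) l≤p ⟨
  ((r ∸ p) + p) ∸ l        ≡⟨ cong (_∸ l) (m∸n+n≡m p≤r) ⟩
  r ∸ l                    ≤⟨ m≤n+o⇒m∸n≤o r l r≤l+g ⟩
  g                        ∎
  where open ≤-Reasoning

cell : ∀ a g M K p → clampedAP a g M 0 ≤ p → p < clampedAP a g M K →
  Σ ℕ λ i → i < K × ∣ clampedAP a g M i - p ∣ + ∣ clampedAP a g M (suc i) - p ∣ ≤ g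
cell a g M K p lo hi =
  let (i , i<K , Pi≤p , p≤Pi+1) = bracket (clampedAP a g M) K p lo hi
  in i , i<K , ends-distance Pi≤p p≤Pi+1 (clampedAP-step a g M i)

clamp : (M x : ℕ) → Fin (suc M)
clamp M x = fromℕ< (s≤s (m⊓n≤n x M))

toℕ-clamp : ∀ M x → toℕ (clamp M x) ≡ x ⊓ M
toℕ-clamp M x = toℕ-fromℕ< (s≤s (m⊓n≤n x M))

odd : ℕ → Bool
odd zero    = false
odd (suc n) = not (odd n)

odd-+-suc : ∀ i j → odd (i + suc j) ≡ not (odd (i + j))
odd-+-suc i j = cong odd (+-suc i j)

OddCell : ℕ × ℕ → Set
OddCell (i , j) = T (odd (i + j))

oddCell? : Decidable OddCell
oddCell? (i , j) = T? (odd (i + j))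

not-T : ∀ b → ¬ T b → T (not b)
not-T false _     = _
not-T true  ¬true = ¬true _

white-right : ∀ {i j} → ¬ OddCell (i , j) → OddCell (suc i , j)
white-right {i} {j} white = not-T (odd (i + j)) white

white-up : ∀ {i j} → ¬ OddCell (i , j) → OddCell (i , suc j)
white-up {i} {j} white rewrite odd-+-suc i j = not-T (odd (i + j)) white

black-diagonal : ∀ {i j} → OddCell (i , j) → OddCell (suc i , suc j)
black-diagonal {i} {j} black rewrite odd-+-suc i j | not-involutive (odd (i + j)) = black

checkerboard : ℕ → ℕ → List (ℕ × ℕ)
checkerboard K L = filter oddCell? (cartesianProduct (downFrom K) (downFrom L))

∈-checkerboard⁺ : ∀ {K L i j} → i < K → j < L → OddCell (i , j) → (i , j) ∈ checkerboard K L
∈-checkerboard⁺ i<K j<L odd =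
  ∈-filter⁺ oddCell? (∈-cartesianProduct⁺ (∈-downFrom⁺ i<K) (∈-downFrom⁺ j<L)) odd

∈-checkerboard⁻ : ∀ {K L i j} → (i , j) ∈ checkerboard K L → i < K × j < L
∈-checkerboard⁻ {K} {L} ij∈ =
  let (i∈ , j∈) = ∈-cartesianProduct⁻ (downFrom K) (downFrom L) (proj₁ (∈-filter⁻ oddCell? ij∈))
  in ∈-downFrom⁻ i∈ , ∈-downFrom⁻ j∈

checkerboard-unique : ∀ K L → Unique (checkerboard K L)
checkerboard-unique K L = filter⁺ oddCell? (cartesianProduct⁺ (downFrom⁺ K) (downFrom⁺ L))

column : ℕ → ℕ → List (ℕ × ℕ)
column i L = filter oddCell? (map (i ,_) (downFrom L))

checkerboard-suc : ∀ K L →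
  length (checkerboard (suc K) L) ≡ length (column K L) + length (checkerboard K L)
checkerboard-suc K L =
  trans (cong length (filter-++ oddCell? (map (K ,_) (downFrom L))
                                        (cartesianProduct (downFrom K) (downFrom L))))
        (length-++ (column K L))

adjacent-columns : ∀ i L → length (column i L) + length (column (suc i) L) ≡ L
adjacent-columns i zero = refl
adjacent-columns i (suc L) with odd (i + L)
... | true  = cong suc (adjacent-columns i L)
... | false = trans (+-suc _ _) (cong suc (adjacent-columns i L))

column-suc : ∀ i L → length (column i (suc L)) ≡ (if odd (i + L) then 1 else 0) + length (column i L)
column-suc i L with odd (i + L)
... | true  = refl
... | false = refl

-- The first column contains at most half of its squares: of two consecutive rows exactly one
-- contributes.
first-column : ∀ L → 2 * length (column 0 L) ≤ L
first-column zero          = z≤n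
first-column (suc zero)    = z≤n
first-column (suc (suc L)) rewrite column-suc 0 (suc L) | column-suc 0 L with odd L
... | true  = subst (_≤ 2 + L) (sym (*-suc 2 _)) (s≤s (s≤s (first-column L)))
... | false = subst (_≤ 2 + L) (sym (*-suc 2 _)) (s≤s (s≤s (first-column L)))

checkerboard-size : ∀ K L → 2 * length (checkerboard K L) ≤ K * L
checkerboard-size zero          L = z≤n
checkerboard-size (suc zero)    L
  rewrite checkerboard-suc 0 L | +-identityʳ (length (column 0 L)) | +-identityʳ L = first-column L
checkerboard-size (suc (suc K)) L
  rewrite checkerboard-suc (suc K) L | checkerboard-suc K L = begin
  2 * (c₁ + (c₀ + b))    ≡⟨ regroup c₁ c₀ b ⟩
  2 * (c₀ + c₁) + 2 * b  ≡⟨ cong (λ x → 2 * x + 2 * b) (adjacent-columns K L) ⟩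
  2 * L + 2 * b          ≤⟨ +-monoʳ-≤ (2 * L) (checkerboard-size K L) ⟩
  2 * L + K * L          ≡⟨ *-distribʳ-+ L 2 K ⟨
  (2 + K) * L            ∎
  where
    open ≤-Reasoning
    c₀ c₁ b : ℕ
    c₀ = length (column K L)
    c₁ = length (column (suc K) L)
    b  = length (checkerboard K L)
    regroup : ∀ c₁ c₀ b → 2 * (c₁ + (c₀ + b)) ≡ 2 * (c₀ + c₁) + 2 * b
    regroup = solve-∀

record SmallBroadcast (m n s B : ℕ) : Set where
  field
    towers    : List (Vertex m n)
    distinct  : Unique towers
    broadcast : IsBroadcast m n (suc s) 2 towers
    size      : length towers * (2 * s ^ 2) ≤ B

relax : ∀ {m n s B B′} → B ≤ B′ → SmallBroadcast m n s B → SmallBroadcast m n s B′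
relax B≤B′ b = record { SmallBroadcast b ; size = ≤-trans (SmallBroadcast.size b) B≤B′ }

^-2 : ∀ s → s ^ 2 ≡ s * s
^-2 s = cong (s *_) (*-identityʳ s)

bounded : ∀ {m n k} → SmallBroadcast m n (suc (suc k)) ((m + 2 * suc k) * (n + 2 * suc k)) →
  Σ (List (Vertex m n)) λ towers → Unique towers ×
    IsBroadcast m n (suc (suc (suc k))) 2 towers × length towers ≤ gridBound m n (suc (suc (suc k)))
bounded {k = k} b = towers , distinct , broadcast ,
  ≤-trans (≤-reflexive (sym (m*n/n≡m (length towers) (2 * suc (suc k) ^ 2)))) (/-monoˡ-≤ _ size)
  where open SmallBroadcast b

opposite-corners : ∀ {s} a₀ a₁ b₀ b₁ → a₀ + a₁ ≤ s → b₀ + b₁ ≤ s →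
  (a₀ + b₀) + (a₁ + b₁) ≤ 2 * s
opposite-corners {s} a₀ a₁ b₀ b₁ row col = begin
  (a₀ + b₀) + (a₁ + b₁)  ≡⟨ +-interchange a₀ b₀ a₁ b₁ ⟩
  (a₀ + a₁) + (b₀ + b₁)  ≤⟨ +-mono-≤ row col ⟩
  s + s                  ≡⟨ cong (s +_) (+-identityʳ s) ⟨
  2 * s                  ∎
  where open ≤-Reasoning

lattice-top : ∀ {g M} (X : Ceiling g M) → clampedAP 0 g M (suc (Ceiling.last X)) ≡ M
lattice-top X = m≥n⇒m⊓n≡n (Ceiling.reaches X)

lattice-cell : ∀ {g M} (X : Ceiling g M) (p : ℕ) → p ≤ M →
  Σ ℕ λ i → i ≤ Ceiling.last X × ∣ clampedAP 0 g M i - p ∣ + ∣ clampedAP 0 g M (suc i) - p ∣ ≤ g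
lattice-cell {g} {M} X p p≤M with m≤n⇒m<n∨m≡n p≤M
... | inj₁ p<M =
  let (i , i<K , ends) = cell 0 g M (suc (Ceiling.last X)) p z≤n (subst (p <_) (sym (lattice-top X)) p<M)
  in i , ≤-pred i<K , ends
... | inj₂ refl = Ceiling.last X , ≤-refl ,
  ends-distance (m⊓n≤n _ M) (≤-reflexive (sym (lattice-top X))) (clampedAP-step 0 g M (Ceiling.last X))

lattice-width : ∀ {c M} (X : Ceiling (suc c) M) → (2 + Ceiling.last X) * suc c ≤ suc M + 2 * c
lattice-width {c} {M} X = begin
  suc c + suc last * suc c  ≤⟨ +-monoʳ-≤ (suc c) (≤-pred (subst (suc last * suc c <_) (+-suc M c) tight)) ⟩
  suc c + (M + c)           ≡⟨ rearrange c M ⟩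
  suc M + 2 * c             ∎
  where
    open ≤-Reasoning
    open Ceiling X
    rearrange : ∀ c M → suc c + (M + c) ≡ suc M + 2 * c
    rearrange = solve-∀

clamp-≡ : ∀ M x y → clamp M x ≡ clamp M y → x ⊓ M ≡ y ⊓ M
clamp-≡ M x y same = trans (sym (toℕ-clamp M x)) (trans (cong toℕ same) (toℕ-clamp M y))

module GridConstruction (c M N : ℕ) (X : Ceiling (suc c) M) (Y : Ceiling (suc c) N) where

  s : ℕ
  s = suc c

  Kx Ky : ℕ
  Kx = Ceiling.last X
  Ky = Ceiling.last Y

  tower : ℕ × ℕ → Vertex (suc M) (suc N)
  tower (i , j) = clamp M (i * s) , clamp N (j * s)

  indices : List (ℕ × ℕ)
  indices = checkerboard (2 + Kx) (2 + Ky)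

  rowDist : Fin (suc M) → ℕ → ℕ
  rowDist p i = ∣ clampedAP 0 s M i - toℕ p ∣

  colDist : Fin (suc N) → ℕ → ℕ
  colDist q j = ∣ clampedAP 0 s N j - toℕ q ∣

  tower-distance : ∀ i j p q → manhattan (tower (i , j)) (p , q) ≡ rowDist p i + colDist q j
  tower-distance i j p q =
    cong₂ (λ x y → ∣ x - toℕ p ∣ + ∣ y - toℕ q ∣) (toℕ-clamp M (i * s)) (toℕ-clamp N (j * s))

  member : ∀ {i j} → i ≤ suc (Kx) → j ≤ suc (Ky) → OddCell (i , j) →
    (i , j) ∈ indices
  member i≤ j≤ = ∈-checkerboard⁺ (s≤s i≤) (s≤s j≤)

  -- A vertex in the lattice cell with lower corner (i , j) is covered by the two black corners
  -- of that cell, which are opposite corners.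
  cell-covered : ∀ p q i j → i ≤ Kx → j ≤ Ky →
    rowDist p i + rowDist p (suc i) ≤ s → colDist q j + colDist q (suc j) ≤ s →
    Covered s tower indices (p , q)
  cell-covered p q i j i≤ j≤ row col with oddCell? (i , j)
  ... | yes black =
    between (member (m≤n⇒m≤1+n i≤) (m≤n⇒m≤1+n j≤) black)
            (member (s≤s i≤) (s≤s j≤) (black-diagonal {i} {j} black))
      (λ same → 1+n≢n (sym (cong proj₁ same)))
      (subst (_≤ 2 * s) (sym (cong₂ _+_ (tower-distance i j p q) (tower-distance (suc i) (suc j) p q)))
        (opposite-corners (rowDist p i) (rowDist p (suc i)) (colDist q j) (colDist q (suc j)) row col))
  ... | no white =
    between (member (s≤s i≤) (m≤n⇒m≤1+n j≤) (white-right {i} {j} white))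
            (member (m≤n⇒m≤1+n i≤) (s≤s j≤) (white-up {i} {j} white))
      (λ same → 1+n≢n (cong proj₁ same))
      (subst (_≤ 2 * s) (sym (cong₂ _+_ (tower-distance (suc i) j p q) (tower-distance i (suc j) p q)))
        (opposite-corners (rowDist p (suc i)) (rowDist p i) (colDist q j) (colDist q (suc j))
          (subst (_≤ s) (+-comm (rowDist p i) (rowDist p (suc i))) row) col))

  covered : (v : Vertex (suc M) (suc N)) → Covered s tower indices v
  covered (p , q) =
    let (i , i≤ , row) = lattice-cell X (toℕ p) (≤-pred (toℕ<n p))
        (j , j≤ , col) = lattice-cell Y (toℕ q) (≤-pred (toℕ<n q))
    in cell-covered p q i j i≤ j≤ row col

  tower-injective : ∀ {x y} → x ∈ indices → y ∈ indices → tower x ≡ tower y → x ≡ y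
  tower-injective {i , j} {i′ , j′} x∈ y∈ same =
    let (i< , j<) = ∈-checkerboard⁻ {2 + Kx} {2 + Ky} x∈
        (i′< , j′<) = ∈-checkerboard⁻ {2 + Kx} {2 + Ky} y∈ in
    cong₂ _,_
      (clampedAP-injective (s≤s z≤n) (Ceiling.tight X) (≤-pred i<) (≤-pred i′<)
        (clamp-≡ M (i * s) (i′ * s) (cong proj₁ same)))
      (clampedAP-injective (s≤s z≤n) (Ceiling.tight Y) (≤-pred j<) (≤-pred j′<)
        (clamp-≡ N (j * s) (j′ * s) (cong proj₂ same)))

  distinct : Unique (map tower indices)
  distinct = map-injectiveOn⁺ tower (checkerboard-unique (2 + Kx) (2 + Ky))
                              tower-injective

  -- At most half of the (Kx + 2)(Ky + 2) lattice points are black, each accounting for s² vertices.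
  size : length (map tower indices) * (2 * s ^ 2) ≤ (suc M + 2 * c) * (suc N + 2 * c)
  size = begin
    length (map tower indices) * (2 * s ^ 2)  ≡⟨ cong (_* (2 * s ^ 2)) (length-map tower indices) ⟩
    length indices * (2 * s ^ 2)              ≡⟨ cong (λ x → length indices * (2 * x)) (^-2 s) ⟩
    length indices * (2 * (s * s))            ≡⟨ square-out (length indices) s ⟩
    (2 * length indices) * (s * s)            ≤⟨ *-monoˡ-≤ (s * s) (checkerboard-size (2 + Kx) (2 + Ky)) ⟩
    ((2 + Kx) * (2 + Ky)) * (s * s)           ≡⟨ spread (2 + Kx) (2 + Ky) s ⟩
    ((2 + Kx) * s) * ((2 + Ky) * s)           ≤⟨ *-mono-≤ (lattice-width X) (lattice-width Y) ⟩
    (suc M + 2 * c) * (suc N + 2 * c)         ∎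
    where
      open ≤-Reasoning
      square-out : ∀ b s → b * (2 * (s * s)) ≡ (2 * b) * (s * s)
      square-out = solve-∀
      spread : ∀ x y s → (x * y) * (s * s) ≡ (x * s) * (y * s)
      spread = solve-∀

grid-broadcast : ∀ c M N →
  SmallBroadcast (suc (suc M)) (suc (suc N)) (suc c) ((suc (suc M) + 2 * c) * (suc (suc N) + 2 * c))
grid-broadcast c M N = record
  { towers    = map tower indices
  ; distinct  = distinct
  ; broadcast = broadcast-of-covered (suc c) tower indices covered
  ; size      = size
  }
  where open GridConstruction c (suc M) (suc N) (ceiling c M) (ceiling c N)

-- R towers spaced g = 2s apart, with R g < N + 2 + g, satisfy the size bound on a line of
-- N + 1 vertices (here s = k + 2, so that t = s + 1 ≥ 3).
line-size : ∀ k N R → R * (2 * (2 + k)) < 2 + N + 2 * (2 + k) →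
  R * (2 * (2 + k) ^ 2) ≤ (1 + 2 * suc k) * (suc N + 2 * suc k)
line-size k N R short = begin
  R * (2 * (2 + k) ^ 2)           ≡⟨ cong (λ x → R * (2 * x)) (^-2 (2 + k)) ⟩
  R * (2 * ((2 + k) * (2 + k)))   ≡⟨ regroup R (2 + k) ⟩
  (R * (2 * (2 + k))) * (2 + k)   ≤⟨ spaced N short ⟩
  (1 + 2 * suc k) * (suc N + 2 * suc k) ∎
  where
    open ≤-Reasoning
    g : ℕ
    g = 2 * (2 + k)
    regroup : ∀ R s → R * (2 * (s * s)) ≡ (R * (2 * s)) * s
    regroup = solve-∀
    expand : ∀ k N → (1 + 2 * suc k) * (2 + N + 2 * suc k) ≡
                     (2 + N + 2 * (2 + k)) * (2 + k) + ((1 + k) * N + 2 * k * k + 4 * k)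
    expand = solve-∀
    expand₀ : ∀ k → (1 + 2 * suc k) * (1 + 2 * suc k) ≡
                    (1 * (2 * (2 + k))) * (2 + k) + (2 * k * k + 4 * k + 1)
    expand₀ = solve-∀
    spaced : ∀ N → R * g < 2 + N + g → (R * g) * (2 + k) ≤ (1 + 2 * suc k) * (suc N + 2 * suc k)
    -- For N ≥ 1, R g s ≤ (N + 1 + g) s already fits under the bound ...
    spaced (suc N) short = begin
      (R * g) * (2 + k)               ≤⟨ *-monoˡ-≤ (2 + k) (≤-pred short) ⟩
      (2 + N + g) * (2 + k)           ≤⟨ m≤m+n _ _ ⟩
      (2 + N + g) * (2 + k) + ((1 + k) * N + 2 * k * k + 4 * k) ≡⟨ expand k N ⟨
      (1 + 2 * suc k) * (2 + N + 2 * suc k) ∎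
    -- ... while for N = 0 the hypothesis R g < 2 + g leaves room for a single tower only.
    spaced zero short = begin
      (R * g) * (2 + k)               ≤⟨ *-monoˡ-≤ (2 + k) (*-monoˡ-≤ g R≤1) ⟩
      (1 * g) * (2 + k)               ≤⟨ m≤m+n _ _ ⟩
      (1 * g) * (2 + k) + (2 * k * k + 4 * k + 1) ≡⟨ expand₀ k ⟨
      (1 + 2 * suc k) * (1 + 2 * suc k) ∎
      where
        2+g≤2g : 2 + g ≤ 2 * g
        2+g≤2g = ≤-trans (+-monoˡ-≤ g (s≤s (s≤s z≤n))) (≤-reflexive (cong (g +_) (sym (+-identityʳ g))))
        R≤1 : R ≤ 1
        R≤1 = ≤-pred (*-cancelʳ-< g R 2 (<-≤-trans short 2+g≤2g))

-- A path of N + 1 vertices embedded isometrically onto G_{m,n}: a grid with a single row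
-- or a single column.
record Line (m n N : ℕ) : Set where
  field
    point    : Fin (suc N) → Vertex m n
    isometry : ∀ a b → manhattan (point a) (point b) ≡ ∣ toℕ a - toℕ b ∣
    onto     : ∀ v → Σ (Fin (suc N)) λ a → point a ≡ v

  point-injective : ∀ {a b} → point a ≡ point b → a ≡ b
  point-injective {a} {b} same = toℕ-injective (∣m-n∣≡0⇒m≡n (begin
    ∣ toℕ a - toℕ b ∣            ≡⟨ isometry a b ⟨
    manhattan (point a) (point b) ≡⟨ cong (manhattan (point a)) same ⟨
    manhattan (point a) (point a) ≡⟨ isometry a a ⟩
    ∣ toℕ a - toℕ a ∣            ≡⟨ ∣n-n∣≡0 (toℕ a) ⟩
    0                             ∎))
    where open ≡-Reasoning

single-row : ∀ N → Line 1 (suc N) N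
single-row N = record
  { point = λ a → fzero , a ; isometry = λ a b → refl ; onto = λ { (fzero , a) → a , refl } }

single-column : ∀ M → Line (suc M) 1 M
single-column M = record
  { point = λ a → a , fzero ; isometry = λ a b → +-identityʳ _ ; onto = λ { (a , fzero) → a , refl } }

module LineConstruction {m n : ℕ} (k N : ℕ) (ℓ : Line m n N) (R : Ceiling (2 * (2 + k)) (2 + N)) where
  open Line ℓ
  open Ceiling R

  c s g : ℕ
  c = suc k
  s = suc c
  g = 2 * s

  position : ℕ → ℕ
  position = clampedAP c g N

  tower : ℕ → Vertex m n
  tower r = point (clamp N (c + r * g))

  indices : List ℕ
  indices = downFrom (suc last)

  tower-distance : ∀ r a → manhattan (tower r) (point a) ≡ ∣ position r - toℕ a ∣
  tower-distance r a = trans (isometry _ a) (cong (λ x → ∣ x - toℕ a ∣) (toℕ-clamp N (c + r * g)))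

  -- The first tower lies within c of every vertex before it ...
  first-near : ∀ p → p ≤ position 0 → ∣ position 0 - p ∣ ≤ c
  first-near p p≤ = begin
    ∣ position 0 - p ∣  ≡⟨ m≤n⇒∣n-m∣≡n∸m p≤ ⟩
    position 0 ∸ p      ≤⟨ m∸n≤m _ p ⟩
    (c + 0) ⊓ N         ≤⟨ m⊓n≤m _ N ⟩
    c + 0               ≡⟨ +-identityʳ c ⟩
    c                   ∎
    where open ≤-Reasoning

  -- ... and, as the unclamped progression ends at least c past N, so does the last tower.
  end-reach : N ≤ c + last * g + c
  end-reach = +-cancelˡ-≤ 2 N _ (≤-trans reaches (≤-reflexive (unfold c last)))
    where
      unfold : ∀ c K → suc K * (2 * suc c) ≡ 2 + (c + K * (2 * suc c) + c)
      unfold = solve-∀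

  last-near : ∀ p → p ≤ N → position last ≤ p → ∣ position last - p ∣ ≤ c
  last-near p p≤N after = begin
    ∣ position last - p ∣  ≡⟨ m≤n⇒∣m-n∣≡n∸m after ⟩
    p ∸ position last      ≤⟨ m≤n+o⇒m∸n≤o p (position last) p≤ ⟩
    c                      ∎
    where
      open ≤-Reasoning
      p≤ : p ≤ position last + c
      p≤ = ≤-trans (⊓-glb (≤-trans p≤N end-reach) (≤-trans p≤N (m≤m+n N c)))
                   (≤-reflexive (sym (+-distribʳ-⊓ c (c + last * g) N)))

  -- Vertices before the first or after the last tower are near it; the others lie between
  -- two consecutive towers, which are g = 2s apart.
  covered-at : (a : Fin (suc N)) → Covered s tower indices (point a)
  covered-at a with toℕ a ≤? position 0
  ... | yes before = near (∈-downFrom⁺ (s≤s z≤n))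
          (subst (_< s) (sym (tower-distance 0 a)) (s≤s (first-near (toℕ a) before)))
  ... | no after with position last ≤? toℕ a
  ...   | yes beyond = near (∈-downFrom⁺ ≤-refl)
          (subst (_< s) (sym (tower-distance last a)) (s≤s (last-near (toℕ a) (≤-pred (toℕ<n a)) beyond)))
  ...   | no inside =
    let (i , i<last , ends) = cell c g N last (toℕ a) (<⇒≤ (≰⇒> after)) (≰⇒> inside) in
    between (∈-downFrom⁺ (m<n⇒m<1+n i<last)) (∈-downFrom⁺ (s≤s i<last)) (λ same → 1+n≢n (sym same))
      (subst (_≤ g) (sym (cong₂ _+_ (tower-distance i a) (tower-distance (suc i) a))) ends)

  covered : (v : Vertex m n) → Covered s tower indices v
  covered v = let (a , a↦v) = onto v in subst (Covered s tower indices) a↦v (covered-at a)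

  -- The towers stay below the cut-off N except possibly the last one, so they are distinct.
  top : c + last * g < N + g
  top = begin-strict
    c + last * g  ≤⟨ +-monoʳ-≤ c (≤-pred (+-cancelʳ-< g (last * g) (2 + N)
                       (subst (_< 2 + N + g) (+-comm g (last * g)) tight))) ⟩
    c + suc N     <⟨ ≤-trans (m≤m+n (suc (c + suc N)) c) (≤-reflexive (sym (gap c N))) ⟩
    N + g         ∎
    where
      open ≤-Reasoning
      gap : ∀ c N → N + 2 * suc c ≡ suc (c + suc N) + c
      gap = solve-∀

  tower-injective : ∀ {r r′} → r ∈ indices → r′ ∈ indices → tower r ≡ tower r′ → r ≡ r′
  tower-injective r∈ r′∈ same =
    clampedAP-injective (s≤s z≤n) top (≤-pred (∈-downFrom⁻ r∈)) (≤-pred (∈-downFrom⁻ r′∈))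
      (clamp-≡ N _ _ (point-injective same))

  distinct : Unique (map tower indices)
  distinct = map-injectiveOn⁺ tower (downFrom⁺ (suc last)) tower-injective

  size : length (map tower indices) * (2 * s ^ 2) ≤ (1 + 2 * c) * (suc N + 2 * c)
  size = subst (λ L → L * (2 * s ^ 2) ≤ (1 + 2 * c) * (suc N + 2 * c))
               (sym (trans (length-map tower indices) (length-downFrom (suc last))))
               (line-size k N (suc last) tight)

line-broadcast : ∀ {m n} k N → Line m n N →
  SmallBroadcast m n (2 + k) ((1 + 2 * suc k) * (suc N + 2 * suc k))
line-broadcast k N ℓ = record
  { towers    = map tower indices
  ; distinct  = distinct
  ; broadcast = broadcast-of-covered (2 + k) tower indices covered
  ; size      = size
  }
  where open LineConstruction k N ℓ (ceiling _ (suc N))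

theorem1 : (m n t : ℕ) → 1 ≤ m → 1 ≤ n → 2 < t →
    Σ (List (Vertex m n)) λ towers →
      Unique towers × IsBroadcast m n t 2 towers × length towers ≤ gridBound m n t
theorem1 (suc zero)    (suc N)       (suc (suc (suc k))) _ _ _ =
  bounded (line-broadcast k N (single-row N))
theorem1 (suc (suc M)) (suc zero)    (suc (suc (suc k))) _ _ _ =
  bounded (relax (≤-reflexive (*-comm (1 + 2 * suc k) (2 + M + 2 * suc k)))
                 (line-broadcast k (suc M) (single-column (suc M))))
theorem1 (suc (suc M)) (suc (suc N)) (suc (suc (suc k))) _ _ _ =
  bounded (grid-broadcast (suc k) M N)
theorem1 zero    _       _                () _  _
theorem1 (suc _) zero    _                _  () _
theorem1 (suc _) (suc _) zero             _  _  ()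
theorem1 (suc _) (suc _) (suc zero)       _  _  (s≤s ())
theorem1 (suc _) (suc _) (suc (suc zero)) _  _  (s≤s (s≤s ()))
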